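{- Let $r \ge 2$ be an integer and let $G$ be an $r$-regular graph. Then \[ \alpha(G) \le \frac{r}{2}\gamma_t(G), \] with equality if and only if $G \in \mathcal{G}_r$.
   Context: All graphs are finite, simple and undirected. $\alpha(G)$ denotes the independence number of $G$ (maximum size of a set of pairwise non-adjacent vertices). A total dominating set of $G$ is a set $S \subseteq V(G)$ such that every vertex of $G$ (including those in $S$) has a neighbor in $S$; $\gamma_t(G)$ is the minimum cardinality of a total dominating set. For $r \ge 2$, $\mathcal{G}_r$ denotes the family of all $r$-regular bipartite graphs $G$ for which there exists a partition $V(G) = A \cup B$ such that the subgraph induced by $A$ is $(r-1)$-regular and the subgraph induced by $B$ is $1$-regular. -}

module Defs where

open import Data.Nat using (ℕ; _≤_; _∸_)
open import Data.Bool using (Bool; true; false; not; _∧_)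
open import Data.Fin using (Fin)
open import Data.Fin.Subset using (Subset; _∈_; _∉_; ∣_∣; ⁅_⁆)
open import Data.Vec using (tabulate; lookup; map)
open import Data.Product using (Σ; _×_; ∃)
open import Relation.Binary.PropositionalEquality using (_≡_; _≢_)

record Graph (n : ℕ) : Set where
  field
    adj       : Fin n → Fin n → Bool
    symmetric : ∀ u v → adj u v ≡ adj v u
    irrefl    : ∀ v → adj v v ≡ false
open Graph public

N : ∀ {n} → Graph n → Fin n → Subset n
N G v = tabulate (λ u → adj G v u)

N-in : ∀ {n} → Graph n → Subset n → Fin n → Subset n
N-in G X v = tabulate (λ u → adj G v u ∧ lookup X u)

degree : ∀ {n} → Graph n → Fin n → ℕ
degree G v = ∣ N G v ∣

Regular : ∀ {n} → ℕ → Graph n → Set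
Regular r G = ∀ v → degree G v ≡ r

Independent : ∀ {n} → Graph n → Subset n → Set
Independent G S = ∀ u v → u ∈ S → v ∈ S → adj G u v ≡ false

IsIndependenceNumber : ∀ {n} → Graph n → ℕ → Set
IsIndependenceNumber G k =
  (Σ (Subset _) λ S → Independent G S × ∣ S ∣ ≡ k)
  × (∀ S → Independent G S → ∣ S ∣ ≤ k)

TotalDominating : ∀ {n} → Graph n → Subset n → Set
TotalDominating G S = ∀ v → ∃ λ u → u ∈ S × adj G v u ≡ true

IsTotalDominationNumber : ∀ {n} → Graph n → ℕ → Set
IsTotalDominationNumber G k =
  (Σ (Subset _) λ S → TotalDominating G S × ∣ S ∣ ≡ k)
  × (∀ S → TotalDominating G S → k ≤ ∣ S ∣)

Bipartite : ∀ {n} → Graph n → Set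
Bipartite {n} G = Σ (Fin n → Bool) λ c → ∀ u v → adj G u v ≡ true → c u ≢ c v

-- 𝒢_r : r-regular bipartite graphs with a partition V = A ∪ B (B the complement of A)
-- such that G[A] is (r-1)-regular and G[B] is 1-regular.
InFamilyG : ∀ {n} → ℕ → Graph n → Set
InFamilyG {n} r G =
  Regular r G × Bipartite G ×
  Σ (Subset n) λ A →
    (∀ v → v ∈ A → ∣ N-in G A v ∣ ≡ r ∸ 1)
    × (∀ v → v ∉ A → ∣ N-in G (map not A) v ∣ ≡ 1)

-- Double counting in an r-regular graph on n vertices. The r|I| edges leaving an
-- independent set I all end outside I, and each outside vertex absorbs at most r
-- of them, so |I| ≤ n − |I|. Every vertex has a neighbour in a total dominating
-- set S, so n ≤ Σ_v |N(v) ∩ S| = r|S|. Hence 2α ≤ n ≤ rγ_t. In the equality case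
-- both counts are tight: all neighbours of a vertex outside I lie in I, so I and
-- its complement form a bipartition, and every vertex has exactly one neighbour
-- in S, which is the partition B = S, A = V ∖ S of 𝒢_r. Conversely, in a graph of
-- 𝒢_r every vertex has exactly one neighbour in B, so rγ_t ≤ r|B| = n ≤ 2α.
module Submission where

open import Defs
open import Data.Nat using (ℕ; _≤_; _*_)
open import Relation.Binary.PropositionalEquality using (_≡_)
open import Data.Product using (_×_)
open import Function.Bundles using (_⇔_)

open import Data.Nat using (zero; suc; _+_; _∸_; z≤n; s≤s; NonZero; >-nonZero; >-nonZero⁻¹)
open import Data.Nat.Properties
open import Algebra.Properties.CommutativeMonoid.Sum +-0-commutativeMonoid
  using (sum; sum-syntax; sum-cong-≗; ∑-distrib-+; ∑-comm)
open import Algebra.Properties.Semiring.Sum +-*-semiring using (*-distribˡ-sum; *-distribʳ-sum)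
open import Data.Bool using (Bool; true; false; not; _∧_)
open import Data.Bool.Properties using (not-involutive)
open import Data.Fin using (Fin; zero; suc)
open import Data.Fin.Subset using (Subset; _∈_; _∉_; ∣_∣; ∁; Nonempty; Empty)
open import Data.Fin.Subset.Properties
  using (_∈?_; nonempty?; Empty-unique; ∣⊥∣≡0; ∣p∣≤n; ∣p∣≤∣x∷p∣; ∣∁p∣≡n∸∣p∣;
         x∈∁p⇒x∉p; x∉p⇒x∈∁p; x∉∁p⇒x∈p)
open import Data.Product using (_,_; proj₁; proj₂)
open import Data.Vec using ([]; _∷_; here; there; tabulate; lookup)
open import Data.Vec.Properties
  using ([]=⇒lookup; lookup⇒[]=; lookup∘tabulate; lookup-map; map-∘; map-cong; map-id)
open import Function using (_∘_; mk⇔)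
open import Relation.Binary.PropositionalEquality
  using (refl; sym; trans; cong; cong₂; subst; _≢_; module ≡-Reasoning)
open import Relation.Nullary using (does; yes; no; contradiction)

χ : Bool → ℕ
χ true  = 1
χ false = 0

χ-∧ : ∀ a b → χ (a ∧ b) ≡ χ a * χ b
χ-∧ true  b = sym (+-identityʳ (χ b))
χ-∧ false b = refl

χ-split : ∀ a b → χ a * χ b + χ a * χ (not b) ≡ χ a
χ-split true  true  = refl
χ-split true  false = refl
χ-split false b     = refl

∑-const : ∀ n k → ∑[ i < n ] k ≡ n * k
∑-const zero    k = refl
∑-const (suc n) k = cong (k +_) (∑-const n k)

∑-mono-≤ : ∀ {n} {f g : Fin n → ℕ} → (∀ i → f i ≤ g i) → sum f ≤ sum g
∑-mono-≤ {zero}  f≤g = z≤n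
∑-mono-≤ {suc n} f≤g = +-mono-≤ (f≤g zero) (∑-mono-≤ (f≤g ∘ suc))

+-tight : ∀ {a b c d} → a ≤ c → b ≤ d → a + b ≡ c + d → a ≡ c × b ≡ d
+-tight {a} {b} {c} {d} a≤c b≤d eq = a≡c , +-cancelˡ-≡ a _ _ (trans eq (cong (_+ _) (sym a≡c)))
  where
  a≡c : a ≡ c
  a≡c = ≤-antisym a≤c (≮⇒≥ (λ a<c → <⇒≢ (+-mono-<-≤ a<c b≤d) eq))

∑-tight : ∀ {n} {f g : Fin n → ℕ} → (∀ i → f i ≤ g i) → sum f ≡ sum g → ∀ i → f i ≡ g i
∑-tight {suc n} f≤g eq zero    = proj₁ (+-tight (f≤g zero) (∑-mono-≤ (f≤g ∘ suc)) eq)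
∑-tight {suc n} f≤g eq (suc i) =
  ∑-tight (f≤g ∘ suc) (proj₂ (+-tight (f≤g zero) (∑-mono-≤ (f≤g ∘ suc)) eq)) i

∣p∣≡∑χ : ∀ {n} (p : Subset n) → ∣ p ∣ ≡ ∑[ i < n ] χ (lookup p i)
∣p∣≡∑χ []          = refl
∣p∣≡∑χ (true  ∷ p) = cong suc (∣p∣≡∑χ p)
∣p∣≡∑χ (false ∷ p) = ∣p∣≡∑χ p

∣tabulate∣≡∑χ : ∀ {n} (f : Fin n → Bool) → ∣ tabulate f ∣ ≡ ∑[ i < n ] χ (f i)
∣tabulate∣≡∑χ f = trans (∣p∣≡∑χ (tabulate f)) (sum-cong-≗ (cong χ ∘ lookup∘tabulate f))

∑-*χ≡*∣p∣ : ∀ {n} k (p : Subset n) → ∑[ i < n ] (k * χ (lookup p i)) ≡ k * ∣ p ∣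
∑-*χ≡*∣p∣ k p = trans (sym (*-distribˡ-sum k (χ ∘ lookup p))) (cong (k *_) (sym (∣p∣≡∑χ p)))

∣p∣+∣∁p∣≡n : ∀ {n} (p : Subset n) → ∣ p ∣ + ∣ ∁ p ∣ ≡ n
∣p∣+∣∁p∣≡n p = trans (cong (∣ p ∣ +_) (∣∁p∣≡n∸∣p∣ p)) (m+[n∸m]≡n (∣p∣≤n p))

2*∣p∣≡n⇒∣p∣≡∣∁p∣ : ∀ {n} (p : Subset n) → 2 * ∣ p ∣ ≡ n → ∣ p ∣ ≡ ∣ ∁ p ∣
2*∣p∣≡n⇒∣p∣≡∣∁p∣ {n} p eq = +-cancelˡ-≡ ∣ p ∣ _ _ (begin
  ∣ p ∣ + ∣ p ∣       ≡⟨ cong (∣ p ∣ +_) (sym (+-identityʳ ∣ p ∣)) ⟩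
  2 * ∣ p ∣           ≡⟨ eq ⟩
  n                   ≡⟨ sym (∣p∣+∣∁p∣≡n p) ⟩
  ∣ p ∣ + ∣ ∁ p ∣     ∎)
  where open ≡-Reasoning

∁-involutive : ∀ {n} (p : Subset n) → ∁ (∁ p) ≡ p
∁-involutive p = trans (sym (map-∘ not not p)) (trans (map-cong not-involutive p) (map-id p))

x∈p⇒1≤∣p∣ : ∀ {n} {x : Fin n} {p : Subset n} → x ∈ p → 1 ≤ ∣ p ∣
x∈p⇒1≤∣p∣ here                        = s≤s z≤n
x∈p⇒1≤∣p∣ (there {y = b} {xs = p} x∈p) = ≤-trans (x∈p⇒1≤∣p∣ x∈p) (∣p∣≤∣x∷p∣ b p)

∣p∣≡0⇒x∉p : ∀ {n} {x : Fin n} {p : Subset n} → ∣ p ∣ ≡ 0 → x ∉ p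
∣p∣≡0⇒x∉p ∣p∣≡0 x∈p = m<n⇒n≢0 (x∈p⇒1≤∣p∣ x∈p) ∣p∣≡0

Empty⇒∣p∣≡0 : ∀ {n} {p : Subset n} → Empty p → ∣ p ∣ ≡ 0
Empty⇒∣p∣≡0 {n} empty = trans (cong ∣_∣ (Empty-unique empty)) (∣⊥∣≡0 n)

1≤∣p∣⇒Nonempty : ∀ {n} (p : Subset n) → 1 ≤ ∣ p ∣ → Nonempty p
1≤∣p∣⇒Nonempty p 1≤∣p∣ with nonempty? p
... | yes nonempty = nonempty
... | no  empty    = contradiction (Empty⇒∣p∣≡0 empty) (m<n⇒n≢0 1≤∣p∣)

∈tabulate⁻ : ∀ {n} {f : Fin n → Bool} {x} → x ∈ tabulate f → f x ≡ true
∈tabulate⁻ {f = f} {x} x∈ = trans (sym (lookup∘tabulate f x)) ([]=⇒lookup x∈)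

∉tabulate⁻ : ∀ {n} {f : Fin n → Bool} {x} → x ∉ tabulate f → f x ≡ false
∉tabulate⁻ {f = f} {x} x∉ with f x in fx
... | true  = contradiction (lookup⇒[]= x _ (trans (lookup∘tabulate f x) fx)) x∉
... | false = refl

PerfectTotalDominating : ∀ {n} → Graph n → Subset n → Set
PerfectTotalDominating G S = ∀ v → ∣ N-in G S v ∣ ≡ 1

module Neighbourhood {n} (G : Graph n) where

  ∈N-in⁻ : ∀ {X v u} → u ∈ N-in G X v → adj G v u ≡ true × u ∈ X
  ∈N-in⁻ {X} {v} {u} u∈ with adj G v u | lookup X u in Xu | ∈tabulate⁻ u∈
  ... | true | true | _ = refl , lookup⇒[]= u X Xu

  ∈N-in⁺ : ∀ {X v u} → adj G v u ≡ true → u ∈ X → u ∈ N-in G X v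
  ∈N-in⁺ {X} {v} {u} vu u∈X = lookup⇒[]= u _ (begin
    lookup (N-in G X v) u     ≡⟨ lookup∘tabulate _ u ⟩
    adj G v u ∧ lookup X u    ≡⟨ cong₂ _∧_ vu ([]=⇒lookup u∈X) ⟩
    true                      ∎)
    where open ≡-Reasoning

  ∣N-in∣≡∑ : ∀ X v → ∣ N-in G X v ∣ ≡ ∑[ u < n ] (χ (adj G v u) * χ (lookup X u))
  ∣N-in∣≡∑ X v = trans (∣tabulate∣≡∑χ (λ u → adj G v u ∧ lookup X u)) (sum-cong-≗ (λ u → χ-∧ (adj G v u) (lookup X u)))

  totalDominating⇒1≤∣N-in∣ : ∀ {S} → TotalDominating G S → ∀ v → 1 ≤ ∣ N-in G S v ∣
  totalDominating⇒1≤∣N-in∣ dominating v with dominating v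
  ... | u , u∈S , vu = x∈p⇒1≤∣p∣ (∈N-in⁺ vu u∈S)

  perfect⇒totalDominating : ∀ S → PerfectTotalDominating G S → TotalDominating G S
  perfect⇒totalDominating S perfect v with 1≤∣p∣⇒Nonempty (N-in G S v) (≤-reflexive (sym (perfect v)))
  ... | u , u∈ with ∈N-in⁻ u∈
  ...   | vu , u∈S = u , u∈S , vu

  monochromatic⇒independent : ∀ {c : Fin n → Bool} {X} b →
    (∀ u v → adj G u v ≡ true → c u ≢ c v) → (∀ u → u ∈ X → c u ≡ b) → Independent G X
  monochromatic⇒independent b proper mono u v u∈X v∈X with adj G u v in uv
  ... | true  = contradiction (trans (mono u u∈X) (sym (mono v v∈X))) (proper u v uv)
  ... | false = refl

  bipartite⇒n≤2α : ∀ {a} → Bipartite G → IsIndependenceNumber G a → n ≤ 2 * a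
  bipartite⇒n≤2α {a} (c , proper) (_ , maximal) = begin
    n                   ≡⟨ sym (∣p∣+∣∁p∣≡n C) ⟩
    ∣ C ∣ + ∣ ∁ C ∣     ≤⟨ +-mono-≤ (maximal C independentC) (maximal (∁ C) independent∁C) ⟩
    a + a               ≡⟨ cong (a +_) (sym (+-identityʳ a)) ⟩
    2 * a               ∎
    where
    open ≤-Reasoning
    C : Subset n
    C = tabulate c
    independentC : Independent G C
    independentC = monochromatic⇒independent true proper (λ _ → ∈tabulate⁻)
    independent∁C : Independent G (∁ C)
    independent∁C = monochromatic⇒independent false proper (λ _ → ∉tabulate⁻ ∘ x∈∁p⇒x∉p)

module RegularGraph {n r} (G : Graph n) (regular : Regular r G) where

  open Neighbourhood G

  ∑adj≡r : ∀ v → ∑[ u < n ] χ (adj G v u) ≡ r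
  ∑adj≡r v = trans (sym (∣tabulate∣≡∑χ (adj G v))) (regular v)

  ∣N-in∣+∣N-in∁∣≡r : ∀ X v → ∣ N-in G X v ∣ + ∣ N-in G (∁ X) v ∣ ≡ r
  ∣N-in∣+∣N-in∁∣≡r X v = begin
    ∣ N-in G X v ∣ + ∣ N-in G (∁ X) v ∣
      ≡⟨ cong₂ _+_ (∣N-in∣≡∑ X v) (∣N-in∣≡∑ (∁ X) v) ⟩
    ∑[ u < n ] (a u * χ (lookup X u)) + ∑[ u < n ] (a u * χ (lookup (∁ X) u))
      ≡⟨ sym (∑-distrib-+ (λ u → a u * χ (lookup X u)) (λ u → a u * χ (lookup (∁ X) u))) ⟩
    ∑[ u < n ] (a u * χ (lookup X u) + a u * χ (lookup (∁ X) u))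
      ≡⟨ sum-cong-≗ (λ u → trans (cong (λ b → a u * χ (lookup X u) + a u * χ b) (lookup-map u not X))
                                 (χ-split (adj G v u) (lookup X u))) ⟩
    ∑[ u < n ] a u
      ≡⟨ ∑adj≡r v ⟩
    r ∎
    where
    open ≡-Reasoning
    a : Fin n → ℕ
    a u = χ (adj G v u)

  handshake : ∀ X → ∑[ v < n ] ∣ N-in G X v ∣ ≡ r * ∣ X ∣
  handshake X = begin
    ∑[ v < n ] ∣ N-in G X v ∣                         ≡⟨ sum-cong-≗ (∣N-in∣≡∑ X) ⟩
    ∑[ v < n ] ∑[ u < n ] (χ (adj G v u) * x u)      ≡⟨ ∑-comm (λ v u → χ (adj G v u) * x u) ⟩
    ∑[ u < n ] ∑[ v < n ] (χ (adj G v u) * x u)      ≡⟨ sum-cong-≗ (λ u → sym (*-distribʳ-sum (x u) (λ v → χ (adj G v u)))) ⟩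
    ∑[ u < n ] ((∑[ v < n ] χ (adj G v u)) * x u)     ≡⟨ sum-cong-≗ (λ u → cong (_* x u) (∑adj≡r′ u)) ⟩
    ∑[ u < n ] (r * x u)                              ≡⟨ ∑-*χ≡*∣p∣ r X ⟩
    r * ∣ X ∣                                         ∎
    where
    open ≡-Reasoning
    x : Fin n → ℕ
    x u = χ (lookup X u)
    ∑adj≡r′ : ∀ u → ∑[ v < n ] χ (adj G v u) ≡ r
    ∑adj≡r′ u = trans (sum-cong-≗ (λ v → cong χ (symmetric G v u))) (∑adj≡r u)

  module _ {I} (independent : Independent G I) where

    ∣N-in∣≡0 : ∀ {v} → v ∈ I → ∣ N-in G I v ∣ ≡ 0
    ∣N-in∣≡0 {v} v∈I = Empty⇒∣p∣≡0 λ (u , u∈) →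
      let vu , u∈I = ∈N-in⁻ u∈ in contradiction (trans (sym vu) (independent v u v∈I u∈I)) λ ()

    ∣N-in∣≤r*χ∁ : ∀ v → ∣ N-in G I v ∣ ≤ r * χ (lookup (∁ I) v)
    ∣N-in∣≤r*χ∁ v rewrite lookup-map v not I with lookup I v in Iv
    ... | true  = ≤-trans (≤-reflexive (∣N-in∣≡0 (lookup⇒[]= v I Iv))) z≤n
    ... | false = ≤-trans (m≤m+n _ _) (≤-reflexive (trans (∣N-in∣+∣N-in∁∣≡r I v) (sym (*-identityʳ r))))

    r*∣I∣≤r*∣∁I∣ : r * ∣ I ∣ ≤ r * ∣ ∁ I ∣
    r*∣I∣≤r*∣∁I∣ = begin
      r * ∣ I ∣                                 ≡⟨ sym (handshake I) ⟩
      ∑[ v < n ] ∣ N-in G I v ∣                 ≤⟨ ∑-mono-≤ ∣N-in∣≤r*χ∁ ⟩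
      ∑[ v < n ] (r * χ (lookup (∁ I) v))       ≡⟨ ∑-*χ≡*∣p∣ r (∁ I) ⟩
      r * ∣ ∁ I ∣                               ∎
      where open ≤-Reasoning

    independent⇒2*∣I∣≤n : .{{NonZero r}} → 2 * ∣ I ∣ ≤ n
    independent⇒2*∣I∣≤n = begin
      2 * ∣ I ∣             ≡⟨ cong (∣ I ∣ +_) (+-identityʳ ∣ I ∣) ⟩
      ∣ I ∣ + ∣ I ∣         ≤⟨ +-monoʳ-≤ ∣ I ∣ (*-cancelˡ-≤ r r*∣I∣≤r*∣∁I∣) ⟩
      ∣ I ∣ + ∣ ∁ I ∣       ≡⟨ ∣p∣+∣∁p∣≡n I ⟩
      n                     ∎
      where open ≤-Reasoning

    -- In the extremal case the handshake bound is tight at every vertex.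
    half⇒neighbour∈I : 2 * ∣ I ∣ ≡ n → ∀ {v u} → v ∉ I → adj G v u ≡ true → u ∈ I
    half⇒neighbour∈I half {v} {u} v∉I vu = x∉∁p⇒x∈p λ u∈∁I →
      ∣p∣≡0⇒x∉p ∣N-in∁∣≡0 (∈N-in⁺ vu u∈∁I)
      where
      ∣N-in∣≡r : ∣ N-in G I v ∣ ≡ r
      ∣N-in∣≡r = begin
        ∣ N-in G I v ∣                    ≡⟨ ∑-tight ∣N-in∣≤r*χ∁ tight v ⟩
        r * χ (lookup (∁ I) v)            ≡⟨ cong (λ b → r * χ b) ([]=⇒lookup (x∉p⇒x∈∁p v∉I)) ⟩
        r * 1                             ≡⟨ *-identityʳ r ⟩
        r                                 ∎
        where
        open ≡-Reasoning
        tight : ∑[ w < n ] ∣ N-in G I w ∣ ≡ ∑[ w < n ] (r * χ (lookup (∁ I) w))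
        tight = trans (handshake I) (trans (cong (r *_) (2*∣p∣≡n⇒∣p∣≡∣∁p∣ I half)) (sym (∑-*χ≡*∣p∣ r (∁ I))))
      ∣N-in∁∣≡0 : ∣ N-in G (∁ I) v ∣ ≡ 0
      ∣N-in∁∣≡0 = +-cancelˡ-≡ r _ 0 (trans (cong (_+ _) (sym ∣N-in∣≡r))
                                           (trans (∣N-in∣+∣N-in∁∣≡r I v) (sym (+-identityʳ r))))

    half⇒bipartite : 2 * ∣ I ∣ ≡ n → Bipartite G
    half⇒bipartite half = (λ u → does (u ∈? I)) , proper
      where
      proper : ∀ u v → adj G u v ≡ true → does (u ∈? I) ≢ does (v ∈? I)
      proper u v uv with u ∈? I | v ∈? I
      ... | yes u∈I | yes v∈I = λ _ → contradiction (trans (sym uv) (independent u v u∈I v∈I)) λ ()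
      ... | no  u∉I | no  v∉I = λ _ → u∉I (half⇒neighbour∈I half v∉I (trans (symmetric G v u) uv))
      ... | yes _   | no  _   = λ ()
      ... | no  _   | yes _   = λ ()

  totalDominating⇒n≤r*∣S∣ : ∀ {S} → TotalDominating G S → n ≤ r * ∣ S ∣
  totalDominating⇒n≤r*∣S∣ {S} dominating = begin
    n                             ≡⟨ sym (trans (∑-const n 1) (*-identityʳ n)) ⟩
    ∑[ v < n ] 1                  ≤⟨ ∑-mono-≤ (totalDominating⇒1≤∣N-in∣ dominating) ⟩
    ∑[ v < n ] ∣ N-in G S v ∣     ≡⟨ handshake S ⟩
    r * ∣ S ∣                     ∎
    where open ≤-Reasoning

  tightTotalDominating⇒perfect : ∀ S → TotalDominating G S → n ≡ r * ∣ S ∣ → PerfectTotalDominating G S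
  tightTotalDominating⇒perfect S dominating n≡r*∣S∣ v =
    sym (∑-tight (totalDominating⇒1≤∣N-in∣ dominating) tight v)
    where
    tight : ∑[ w < n ] 1 ≡ ∑[ w < n ] ∣ N-in G S w ∣
    tight = trans (∑-const n 1) (trans (*-identityʳ n) (trans n≡r*∣S∣ (sym (handshake S))))

  perfect⇒n≡r*∣S∣ : ∀ S → PerfectTotalDominating G S → n ≡ r * ∣ S ∣
  perfect⇒n≡r*∣S∣ S perfect = begin
    n                             ≡⟨ sym (trans (∑-const n 1) (*-identityʳ n)) ⟩
    ∑[ v < n ] 1                  ≡⟨ sum-cong-≗ (sym ∘ perfect) ⟩
    ∑[ v < n ] ∣ N-in G S v ∣     ≡⟨ handshake S ⟩
    r * ∣ S ∣                     ∎
    where open ≡-Reasoning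

  perfect⇒∣N-in∁∣≡r∸1 : ∀ S → PerfectTotalDominating G S → ∀ v → ∣ N-in G (∁ S) v ∣ ≡ r ∸ 1
  perfect⇒∣N-in∁∣≡r∸1 S perfect v = begin
    ∣ N-in G (∁ S) v ∣                      ≡⟨ sym (m+n∸m≡n 1 _) ⟩
    1 + ∣ N-in G (∁ S) v ∣ ∸ 1              ≡⟨ cong (λ k → k + ∣ N-in G (∁ S) v ∣ ∸ 1) (sym (perfect v)) ⟩
    ∣ N-in G S v ∣ + ∣ N-in G (∁ S) v ∣ ∸ 1 ≡⟨ cong (_∸ 1) (∣N-in∣+∣N-in∁∣≡r S v) ⟩
    r ∸ 1                                   ∎
    where open ≡-Reasoning

  partition⇒perfect : .{{NonZero r}} → ∀ A →
    (∀ v → v ∈ A → ∣ N-in G A v ∣ ≡ r ∸ 1) → (∀ v → v ∉ A → ∣ N-in G (∁ A) v ∣ ≡ 1) →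
    PerfectTotalDominating G (∁ A)
  partition⇒perfect A insideA insideB v with v ∈? A
  ... | no  v∉A = insideB v v∉A
  ... | yes v∈A = +-cancelˡ-≡ (r ∸ 1) _ 1 (begin
    r ∸ 1 + ∣ N-in G (∁ A) v ∣              ≡⟨ cong (_+ ∣ N-in G (∁ A) v ∣) (sym (insideA v v∈A)) ⟩
    ∣ N-in G A v ∣ + ∣ N-in G (∁ A) v ∣     ≡⟨ ∣N-in∣+∣N-in∁∣≡r A v ⟩
    r                                       ≡⟨ sym (m∸n+n≡m (>-nonZero⁻¹ r)) ⟩
    r ∸ 1 + 1                               ∎)
    where open ≡-Reasoning

theorem1 : ∀ {n} (r : ℕ) → 2 ≤ r → (G : Graph n) → Regular r G →
    ∀ a t → IsIndependenceNumber G a → IsTotalDominationNumber G t →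
    (2 * a ≤ r * t) × ((2 * a ≡ r * t) ⇔ InFamilyG r G)
theorem1 {n} r 2≤r G regular a t α@((I , independent , refl) , _) ((S , dominating , refl) , minimal) =
  2α≤rγ , mk⇔ equality⇒family family⇒equality
  where
  open Neighbourhood G
  open RegularGraph G regular
  instance
    r≢0 : NonZero r
    r≢0 = >-nonZero (≤-trans (s≤s z≤n) 2≤r)
  2α≤n : 2 * ∣ I ∣ ≤ n
  2α≤n = independent⇒2*∣I∣≤n independent
  n≤rγ : n ≤ r * ∣ S ∣
  n≤rγ = totalDominating⇒n≤r*∣S∣ dominating
  2α≤rγ : 2 * ∣ I ∣ ≤ r * ∣ S ∣
  2α≤rγ = ≤-trans 2α≤n n≤rγ

  equality⇒family : 2 * ∣ I ∣ ≡ r * ∣ S ∣ → InFamilyG r G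
  equality⇒family eq = regular , half⇒bipartite independent (sym n≡2α) , ∁ S ,
    (λ v _ → perfect⇒∣N-in∁∣≡r∸1 S perfect v) , (λ v _ → subst (λ X → ∣ N-in G X v ∣ ≡ 1) (sym (∁-involutive S)) (perfect v))
    where
    n≡2α : n ≡ 2 * ∣ I ∣
    n≡2α = ≤-antisym (≤-trans n≤rγ (≤-reflexive (sym eq))) 2α≤n
    perfect : PerfectTotalDominating G S
    perfect = tightTotalDominating⇒perfect S dominating (trans n≡2α eq)

  family⇒equality : InFamilyG r G → 2 * ∣ I ∣ ≡ r * ∣ S ∣
  family⇒equality (_ , bipartite , A , insideA , insideB) = ≤-antisym 2α≤rγ (begin
    r * ∣ S ∣       ≤⟨ *-monoʳ-≤ r (minimal (∁ A) (perfect⇒totalDominating (∁ A) perfect)) ⟩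
    r * ∣ ∁ A ∣     ≡⟨ sym (perfect⇒n≡r*∣S∣ (∁ A) perfect) ⟩
    n               ≤⟨ bipartite⇒n≤2α bipartite α ⟩
    2 * ∣ I ∣       ∎)
    where
    open ≤-Reasoning
    perfect : PerfectTotalDominating G (∁ A)
    perfect = partition⇒perfect A insideA insideB
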